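{- For the simplification $r_1$ and for any formula $A^{Ko}$ (the Kolmogorov translation of a formula $A$) there is a simplification path $P_{r_1}$ from $A^{Ko}$ such that \[ s(P_{r_1}) = (\#^{A^{Ko}}_\wedge) + (\#^{A^{Ko}}_\vee) + (\#^{A^{Ko}}_\to) + (\#^{A^{Ko}}_\exists) \] and the formula in the last node can be obtained from $A^{Ko}$ by locating in this formula all the occurrences of conjunctions, disjunctions, implications and existential quantifications and removing at once all the double negations from inside these connectives and quantifiers. Any simplification $r'_1$ obtained from $r_1$ by removing one or more transformations admits a similar result, discounting and disregarding the logical symbols in the left-hand side of the transformations removed.
   Context: Logic: classical (CL) and intuitionistic (IL) first-order logic with primitives $\bot,\top,\wedge,\vee,\to,\forall,\exists$; $\neg A$ abbreviates $A\to\bot$. Kolmogorov translation $A^{Ko}$: $P^{Ko}:\equiv\neg\neg P$ ($P$ atomic), $(A\wedge B)^{Ko}:\equiv\neg\neg(A^{Ko}\wedge B^{Ko})$, $(A\vee B)^{Ko}:\equiv\neg\neg(A^{Ko}\vee B^{Ko})$, $(A\to B)^{Ko}:\equiv\neg\neg(A^{Ko}\to B^{Ko})$, $(\forall xA)^{Ko}:\equiv\neg\neg\forall x A^{Ko}$, $(\exists xA)^{Ko}:\equiv\neg\neg\exists x A^{Ko}$. The simplification $r_1$ is the set of transformations $\neg\neg(\neg\neg A\wedge\neg\neg B)\Rightarrow\neg\neg(A\wedge B)$, $\neg\neg(\neg\neg A\vee\neg\neg B)\Rightarrow\neg\neg(A\vee B)$, $\neg\neg(\neg\neg A\to\neg\neg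 B)\Rightarrow\neg\neg(A\to B)$, $\neg\neg\exists x\neg\neg A\Rightarrow\neg\neg\exists xA$. Applying a simplification to a formula means changing it through successive steps, each step replacing a subformula having the shape of the left-hand side of one of its transformations by the corresponding right-hand side, until no further step is possible; the resulting sequence of formulas (nodes) is a simplification path. Its length $s(P)$ is the number of steps (number of nodes minus one). All simplification paths are considered to start at formulas of the form $A^{Ko}$. $\#^A_\square$ and $\#^A_Q$ denote the number of occurrences of the symbol $\square\in\{\wedge,\vee,\to\}$ or $Q\in\{\forall,\exists\}$ in $A$; the negation symbols introduced by the translation are considered primitive and are not counted as implications (so $\#^A_\to=\#^{A^{Ko}}_\to$). "Removing the double negations from inside" over $\square$ or $Q$ means replacing $\neg\neg(\neg\neg A\,\square\,\neg\neg B)$ by $\neg\neg(A\,\square\,B)$, or $\neg\neg Qx\neg\neg A$ by $\neg\neg QxA$. -}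

module Defs where

open import Data.Nat using (ℕ; zero; suc; _+_)
open import Data.Bool using (Bool; true; false; T; if_then_else_)
open import Data.Empty using (⊥)
open import Relation.Nullary using (¬_)

-- Variables are natural numbers; atomic formulas P (a predicate applied
-- to terms) are drawn from an arbitrary type Atom.
Var : Set
Var = ℕ

-- Source formulas A of first-order logic: primitives ⊥, ⊤, ∧, ∨, →, ∀, ∃
-- (¬A abbreviates A → ⊥ here, so it is an implication).
infixr 6 _∧_
infixr 5 _∨_
infixr 4 _⇒_

data Form (Atom : Set) : Set where
  atom : Atom → Form Atom
  bot  : Form Atom
  top  : Form Atom
  _∧_  : Form Atom → Form Atom → Form Atom
  _∨_  : Form Atom → Form Atom → Form Atom
  _⇒_  : Form Atom → Form Atom → Form Atom
  all  : Var → Form Atom → Form Atom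
  ex   : Var → Form Atom → Form Atom

-- Target formulas: same language plus a PRIMITIVE negation symbol `neg`
-- (the negations introduced by the translation are primitive and are not
-- counted as implications).
data NForm (Atom : Set) : Set where
  atom : Atom → NForm Atom
  bot  : NForm Atom
  top  : NForm Atom
  neg  : NForm Atom → NForm Atom
  _∧_  : NForm Atom → NForm Atom → NForm Atom
  _∨_  : NForm Atom → NForm Atom → NForm Atom
  _⇒_  : NForm Atom → NForm Atom → NForm Atom
  all  : Var → NForm Atom → NForm Atom
  ex   : Var → NForm Atom → NForm Atom

module _ {Atom : Set} where

  infix 8 ¬¬_
  ¬¬_ : NForm Atom → NForm Atom
  ¬¬ A = neg (neg A)

  -- Kolmogorov translation; ⊥ and ⊤ are treated as atomic formulas.
  ko : Form Atom → NForm Atom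
  ko (atom p) = ¬¬ atom p
  ko bot      = ¬¬ bot
  ko top      = ¬¬ top
  ko (A ∧ B)  = ¬¬ (ko A ∧ ko B)
  ko (A ∨ B)  = ¬¬ (ko A ∨ ko B)
  ko (A ⇒ B)  = ¬¬ (ko A ⇒ ko B)
  ko (all x A) = ¬¬ all x (ko A)
  ko (ex x A)  = ¬¬ ex x (ko A)

-- The four transformations of r₁, named by the symbol they act over.
data Kind : Set where
  kConj kDisj kImp kEx : Kind

-- A simplification obtained from r₁ by keeping a subset of its
-- transformations: S k ≡ true means transformation k is kept.
RuleSet : Set
RuleSet = Kind → Bool

r₁ : RuleSet
r₁ _ = true

module _ {Atom : Set} (S : RuleSet) where

  data Root : NForm Atom → NForm Atom → Set where
    rConj : ∀ {A B} → T (S kConj) → Root (¬¬ (¬¬ A ∧ ¬¬ B)) (¬¬ (A ∧ B))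
    rDisj : ∀ {A B} → T (S kDisj) → Root (¬¬ (¬¬ A ∨ ¬¬ B)) (¬¬ (A ∨ B))
    rImp  : ∀ {A B} → T (S kImp)  → Root (¬¬ (¬¬ A ⇒ ¬¬ B)) (¬¬ (A ⇒ B))
    rEx   : ∀ {x A} → T (S kEx)   → Root (¬¬ ex x (¬¬ A)) (¬¬ ex x A)

  data Step : NForm Atom → NForm Atom → Set where
    here : ∀ {A B} → Root A B → Step A B
    neg· : ∀ {A A'} → Step A A' → Step (neg A) (neg A')
    ∧ˡ   : ∀ {A A' B} → Step A A' → Step (A ∧ B) (A' ∧ B)
    ∧ʳ   : ∀ {A B B'} → Step B B' → Step (A ∧ B) (A ∧ B')
    ∨ˡ   : ∀ {A A' B} → Step A A' → Step (A ∨ B) (A' ∨ B)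
    ∨ʳ   : ∀ {A B B'} → Step B B' → Step (A ∨ B) (A ∨ B')
    ⇒ˡ   : ∀ {A A' B} → Step A A' → Step (A ⇒ B) (A' ⇒ B)
    ⇒ʳ   : ∀ {A B B'} → Step B B' → Step (A ⇒ B) (A ⇒ B')
    all· : ∀ {x A A'} → Step A A' → Step (all x A) (all x A')
    ex·  : ∀ {x A A'} → Step A A' → Step (ex x A) (ex x A')

  Normal : NForm Atom → Set
  Normal A = ∀ B → ¬ Step A B

  data Steps : NForm Atom → NForm Atom → Set where
    done : ∀ {A} → Steps A A
    _∷_  : ∀ {A B C} → Step A B → Steps B C → Steps A C

  -- Number of steps (number of nodes minus one).
  len : ∀ {A B} → Steps A B → ℕ
  len done     = 0
  len (_ ∷ p)  = suc (len p)

  record Path (A B : NForm Atom) : Set where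
    constructor path
    field
      steps  : Steps A B
      normal : Normal B

  s : ∀ {A B} → Path A B → ℕ
  s p = len (Path.steps p)

module _ {Atom : Set} where

  # : Kind → NForm Atom → ℕ
  # k (atom _)  = 0
  # k bot       = 0
  # k top       = 0
  # k (neg A)   = # k A
  # kConj (A ∧ B) = suc (# kConj A + # kConj B)
  # k     (A ∧ B) = # k A + # k B
  # kDisj (A ∨ B) = suc (# kDisj A + # kDisj B)
  # k     (A ∨ B) = # k A + # k B
  # kImp  (A ⇒ B) = suc (# kImp A + # kImp B)
  # k     (A ⇒ B) = # k A + # k B
  # k     (all x A) = # k A
  # kEx   (ex x A)  = suc (# kEx A)
  # k     (ex x A)  = # k A

  weight : RuleSet → NForm Atom → ℕ
  weight S A =
    (if S kConj then # kConj A else 0) + (if S kDisj then # kDisj A else 0) +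
    (if S kImp then # kImp A else 0) + (if S kEx then # kEx A else 0)

  strip : NForm Atom → NForm Atom
  strip (neg (neg A)) = A
  strip A = A

  removeInside : RuleSet → NForm Atom → NForm Atom
  removeInside S (atom p) = atom p
  removeInside S bot = bot
  removeInside S top = top
  removeInside S (neg A) = neg (removeInside S A)
  removeInside S (A ∧ B) =
    if S kConj then strip (removeInside S A) ∧ strip (removeInside S B)
    else removeInside S A ∧ removeInside S B
  removeInside S (A ∨ B) =
    if S kDisj then strip (removeInside S A) ∨ strip (removeInside S B)
    else removeInside S A ∨ removeInside S B
  removeInside S (A ⇒ B) =
    if S kImp then strip (removeInside S A) ⇒ strip (removeInside S B)
    else removeInside S A ⇒ removeInside S B
  removeInside S (all x A) = all x (removeInside S A)
  removeInside S (ex x A) =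
    if S kEx then ex x (strip (removeInside S A))
    else ex x (removeInside S A)

module Submission where

-- Every translated formula
-- A^Ko is a double negation ¬¬ X, and we describe the final node of the
-- path by its "core": core A is A^Ko with the outer ¬¬ dropped and, under
-- every occurrence of a kept connective or quantifier, the double negations
-- in front of the immediate subformulas removed.
--
--   1. removeInside S (A^Ko) ≡ ¬¬ core A               (removeInside-ko)
--   2. A^Ko reduces to ¬¬ core A in exactly weight S (A^Ko) steps: first
--      reduce the immediate subformulas (by induction), then apply the kept
--      transformation at the head once, if there is one    (ko-reduces)
--   3. ¬¬ core A admits no further step: a core is never a negation, so a
--      transformation can only fire at the head of a kept symbol, where the
--      double negations have already been removed          (¬¬core-normal)

open import Defs
open import Data.Bool using (Bool; true; false; T; if_then_else_)
open import Data.Nat using (ℕ; suc; _+_)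
open import Data.Nat.Properties using (+-comm; +-identityʳ)
open import Data.Nat.Tactic.RingSolver using (solve-∀)
open import Data.Product using (Σ; _×_; _,_)
open import Data.Unit using (tt)
open import Relation.Nullary using (¬_)
open import Relation.Binary.PropositionalEquality
  using (_≡_; refl; sym; trans; cong; cong₂; subst; module ≡-Reasoning)
open ≡-Reasoning

data Bin : Set where
  conj disj imp : Bin

kindOf : Bin → Kind
kindOf conj = kConj
kindOf disj = kDisj
kindOf imp  = kImp

unit : Kind → Kind → ℕ
unit kConj kConj = 1
unit kDisj kDisj = 1
unit kImp  kImp  = 1
unit kEx   kEx   = 1
unit _     _     = 0

kept : Bool → ℕ → ℕ
kept b n = if b then n else 0

kept-0 : ∀ b → kept b 0 ≡ 0
kept-0 true  = refl
kept-0 false = refl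

kept-+ : ∀ b m n → kept b (m + n) ≡ kept b m + kept b n
kept-+ true  m n = refl
kept-+ false m n = refl

Σk : (Kind → ℕ) → ℕ
Σk f = f kConj + f kDisj + f kImp + f kEx

Σk-cong : ∀ {f g : Kind → ℕ} → (∀ k → f k ≡ g k) → Σk f ≡ Σk g
Σk-cong {f} {g} eq
  rewrite eq kConj | eq kDisj | eq kImp | eq kEx = refl

Σk-+ : ∀ (f g : Kind → ℕ) → Σk (λ k → f k + g k) ≡ Σk f + Σk g
Σk-+ f g = regroup (f kConj) (f kDisj) (f kImp) (f kEx)
                   (g kConj) (g kDisj) (g kImp) (g kEx)
  where
  regroup : ∀ a b c d a' b' c' d' →
    (a + a') + (b + b') + (c + c') + (d + d') ≡ (a + b + c + d) + (a' + b' + c' + d')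
  regroup = solve-∀

Σk-unit : ∀ (S : RuleSet) k₀ → Σk (λ k → kept (S k) (unit k₀ k)) ≡ kept (S k₀) 1
Σk-unit S kConj rewrite kept-0 (S kDisj) | kept-0 (S kImp) | kept-0 (S kEx) =
  trans (+-identityʳ _) (trans (+-identityʳ _) (+-identityʳ _))
Σk-unit S kDisj rewrite kept-0 (S kConj) | kept-0 (S kImp) | kept-0 (S kEx) =
  trans (+-identityʳ _) (+-identityʳ _)
Σk-unit S kImp rewrite kept-0 (S kConj) | kept-0 (S kDisj) | kept-0 (S kEx) =
  +-identityʳ _
Σk-unit S kEx rewrite kept-0 (S kConj) | kept-0 (S kDisj) | kept-0 (S kImp) = refl

wrap : {Atom : Set} → Bool → NForm Atom → NForm Atom
wrap true  X = X
wrap false X = ¬¬ X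

-- Negations.  Every left-hand side starts with ¬¬, so a transformation can
-- fire at ¬ X only if X is itself a negation.
data IsNeg {Atom : Set} : NForm Atom → Set where
  negation : ∀ {X} → IsNeg (neg X)

module _ {Atom : Set} where

  bin : Bin → NForm Atom → NForm Atom → NForm Atom
  bin conj = _∧_
  bin disj = _∨_
  bin imp  = _⇒_

  #-bin : ∀ o k (X Y : NForm Atom) → # k (bin o X Y) ≡ unit (kindOf o) k + (# k X + # k Y)
  #-bin conj kConj X Y = refl
  #-bin conj kDisj X Y = refl
  #-bin conj kImp  X Y = refl
  #-bin conj kEx   X Y = refl
  #-bin disj kConj X Y = refl
  #-bin disj kDisj X Y = refl
  #-bin disj kImp  X Y = refl
  #-bin disj kEx   X Y = refl
  #-bin imp  kConj X Y = refl
  #-bin imp  kDisj X Y = refl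
  #-bin imp  kImp  X Y = refl
  #-bin imp  kEx   X Y = refl

  #-ex : ∀ k x (X : NForm Atom) → # k (ex x X) ≡ unit kEx k + # k X
  #-ex kConj x X = refl
  #-ex kDisj x X = refl
  #-ex kImp  x X = refl
  #-ex kEx   x X = refl

  weight-zero : ∀ S (X : NForm Atom) → (∀ k → # k X ≡ 0) → weight S X ≡ 0
  weight-zero S X none = Σk-cong (λ k → trans (cong (kept (S k)) (none k)) (kept-0 (S k)))

  weight-bin : ∀ S o (X Y : NForm Atom) →
    weight S (bin o X Y) ≡ kept (S (kindOf o)) 1 + (weight S X + weight S Y)
  weight-bin S o X Y = begin
    Σk (λ k → kept (S k) (# k (bin o X Y)))
      ≡⟨ Σk-cong split ⟩
    Σk (λ k → kept (S k) (unit (kindOf o) k) + (kept (S k) (# k X) + kept (S k) (# k Y)))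
      ≡⟨ Σk-+ (λ k → kept (S k) (unit (kindOf o) k)) (λ k → kept (S k) (# k X) + kept (S k) (# k Y)) ⟩
    Σk (λ k → kept (S k) (unit (kindOf o) k)) + Σk (λ k → kept (S k) (# k X) + kept (S k) (# k Y))
      ≡⟨ cong₂ _+_ (Σk-unit S (kindOf o)) (Σk-+ (λ k → kept (S k) (# k X)) (λ k → kept (S k) (# k Y))) ⟩
    kept (S (kindOf o)) 1 + (weight S X + weight S Y) ∎
    where
    split : ∀ k → kept (S k) (# k (bin o X Y)) ≡
      kept (S k) (unit (kindOf o) k) + (kept (S k) (# k X) + kept (S k) (# k Y))
    split k = begin
      kept (S k) (# k (bin o X Y))
        ≡⟨ cong (kept (S k)) (#-bin o k X Y) ⟩
      kept (S k) (unit (kindOf o) k + (# k X + # k Y))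
        ≡⟨ kept-+ (S k) _ _ ⟩
      kept (S k) (unit (kindOf o) k) + kept (S k) (# k X + # k Y)
        ≡⟨ cong (kept (S k) (unit (kindOf o) k) +_) (kept-+ (S k) _ _) ⟩
      kept (S k) (unit (kindOf o) k) + (kept (S k) (# k X) + kept (S k) (# k Y)) ∎

  weight-ex : ∀ S x (X : NForm Atom) → weight S (ex x X) ≡ kept (S kEx) 1 + weight S X
  weight-ex S x X = begin
    Σk (λ k → kept (S k) (# k (ex x X)))
      ≡⟨ Σk-cong (λ k → trans (cong (kept (S k)) (#-ex k x X)) (kept-+ (S k) (unit kEx k) (# k X))) ⟩
    Σk (λ k → kept (S k) (unit kEx k) + kept (S k) (# k X))
      ≡⟨ Σk-+ (λ k → kept (S k) (unit kEx k)) (λ k → kept (S k) (# k X)) ⟩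
    Σk (λ k → kept (S k) (unit kEx k)) + weight S X
      ≡⟨ cong (_+ weight S X) (Σk-unit S kEx) ⟩
    kept (S kEx) 1 + weight S X ∎

module _ {Atom : Set} (S : RuleSet) where

  N : Set
  N = NForm Atom

  infixr 5 _∷_ _++_
  infix 4 _↠[_]_
  data _↠[_]_ : N → ℕ → N → Set where
    done : ∀ {X} → X ↠[ 0 ] X
    _∷_  : ∀ {X Y Z n} → Step S X Y → Y ↠[ n ] Z → X ↠[ suc n ] Z

  _++_ : ∀ {X Y Z m n} → X ↠[ m ] Y → Y ↠[ n ] Z → X ↠[ m + n ] Z
  done     ++ q = q
  (s ∷ p)  ++ q = s ∷ (p ++ q)

  cast : ∀ {X Y m n} → m ≡ n → X ↠[ m ] Y → X ↠[ n ] Y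
  cast refl p = p

  under : (f : N → N) → (∀ {X Y} → Step S X Y → Step S (f X) (f Y)) →
          ∀ {X Y n} → X ↠[ n ] Y → f X ↠[ n ] f Y
  under f step done    = done
  under f step (s ∷ p) = step s ∷ under f step p

  toSteps : ∀ {X Y n} → X ↠[ n ] Y → Σ (Steps S X Y) (λ p → len S p ≡ n)
  toSteps done = done , refl
  toSteps (s ∷ p) with toSteps p
  ... | q , len-q = (s ∷ q) , cong suc len-q

  ¬¬-step : ∀ {X Y : N} → Step S X Y → Step S (¬¬ X) (¬¬ Y)
  ¬¬-step s = neg· (neg· s)

  binˡ : ∀ o {X X' Y : N} → Step S X X' → Step S (bin o X Y) (bin o X' Y)
  binˡ conj = ∧ˡ
  binˡ disj = ∨ˡ
  binˡ imp  = ⇒ˡ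

  binʳ : ∀ o {X Y Y' : N} → Step S Y Y' → Step S (bin o X Y) (bin o X Y')
  binʳ conj = ∧ʳ
  binʳ disj = ∨ʳ
  binʳ imp  = ⇒ʳ

  root-bin : ∀ o {X Y : N} → T (S (kindOf o)) →
    Root S (¬¬ bin o (¬¬ X) (¬¬ Y)) (¬¬ bin o X Y)
  root-bin conj = rConj
  root-bin disj = rDisj
  root-bin imp  = rImp

  contract-bin : ∀ o b → S (kindOf o) ≡ b → ∀ {X Y : N} →
    ¬¬ bin o (¬¬ X) (¬¬ Y) ↠[ kept b 1 ] ¬¬ bin o (wrap b X) (wrap b Y)
  contract-bin o true  on = here (root-bin o (subst T (sym on) tt)) ∷ done
  contract-bin o false _  = done

  contract-ex : ∀ b → S kEx ≡ b → ∀ {x} {X : N} →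
    ¬¬ ex x (¬¬ X) ↠[ kept b 1 ] ¬¬ ex x (wrap b X)
  contract-ex true  on = here (rEx (subst T (sym on) tt)) ∷ done
  contract-ex false _  = done

  reduce-bin : ∀ o {X X' Y Y' : N} {m n} → X ↠[ m ] ¬¬ X' → Y ↠[ n ] ¬¬ Y' →
    ¬¬ bin o X Y ↠[ kept (S (kindOf o)) 1 + (m + n) ]
      ¬¬ bin o (wrap (S (kindOf o)) X') (wrap (S (kindOf o)) Y')
  reduce-bin o {m = m} {n} pX pY =
    cast (reorder m n _)
      (under (λ X → ¬¬ bin o X _) (λ s → ¬¬-step (binˡ o s)) pX
      ++ under (λ Y → ¬¬ bin o _ Y) (λ s → ¬¬-step (binʳ o s)) pY
      ++ contract-bin o (S (kindOf o)) refl)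
    where
    reorder : ∀ m n k → m + (n + k) ≡ k + (m + n)
    reorder = solve-∀

  root-under-neg : ∀ {X C : N} → Root S (neg X) C → IsNeg X
  root-under-neg (rConj _) = negation
  root-under-neg (rDisj _) = negation
  root-under-neg (rImp _)  = negation
  root-under-neg (rEx _)   = negation

  normal-¬¬ : ∀ {X : N} → Normal S X → ¬ IsNeg X → (∀ {C : N} → ¬ Root S (¬¬ X) C) →
    Normal S (¬¬ X)
  normal-¬¬ _   _      no-root _ (here r)         = no-root r
  normal-¬¬ _   not-neg _      _ (neg· (here r))  = not-neg (root-under-neg r)
  normal-¬¬ n-X _      _       _ (neg· (neg· s))  = n-X _ s

  normal-wrap : ∀ b {X : N} → Normal S X → Normal S (¬¬ X) → Normal S (wrap b X)
  normal-wrap true  n-X _     = n-X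
  normal-wrap false _   n¬¬X  = n¬¬X

  normal-bin : ∀ o {X Y : N} → Normal S X → Normal S Y → Normal S (bin o X Y)
  normal-bin conj _   _   _ (here ())
  normal-bin conj n-X _   _ (∧ˡ s) = n-X _ s
  normal-bin conj _   n-Y _ (∧ʳ s) = n-Y _ s
  normal-bin disj _   _   _ (here ())
  normal-bin disj n-X _   _ (∨ˡ s) = n-X _ s
  normal-bin disj _   n-Y _ (∨ʳ s) = n-Y _ s
  normal-bin imp  _   _   _ (here ())
  normal-bin imp  n-X _   _ (⇒ˡ s) = n-X _ s
  normal-bin imp  _   n-Y _ (⇒ʳ s) = n-Y _ s

  normal-all : ∀ {x} {X : N} → Normal S X → Normal S (all x X)
  normal-all _   _ (here ())
  normal-all n-X _ (all· s) = n-X _ s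

  normal-ex : ∀ {x} {X : N} → Normal S X → Normal S (ex x X)
  normal-ex _   _ (here ())
  normal-ex n-X _ (ex· s) = n-X _ s

  -- Once the double negations under a kept head are removed, the head is
  -- no longer a redex: the sides are not negations.
  no-root-bin : ∀ o b → S (kindOf o) ≡ b → ∀ {X Y C : N} → ¬ IsNeg X →
    ¬ Root S (¬¬ bin o (wrap b X) (wrap b Y)) C
  no-root-bin conj true  _   not-neg (rConj _) = not-neg negation
  no-root-bin disj true  _   not-neg (rDisj _) = not-neg negation
  no-root-bin imp  true  _   not-neg (rImp _)  = not-neg negation
  no-root-bin conj false off _       (rConj t) = subst T off t
  no-root-bin disj false off _       (rDisj t) = subst T off t
  no-root-bin imp  false off _       (rImp t)  = subst T off t

  no-root-ex : ∀ b → S kEx ≡ b → ∀ {x} {X C : N} → ¬ IsNeg X →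
    ¬ Root S (¬¬ ex x (wrap b X)) C
  no-root-ex true  _   not-neg (rEx _) = not-neg negation
  no-root-ex false off _       (rEx t) = subst T off t

  -- The last node of the path, without its outer double negation.
  core : Form Atom → N
  core (atom p)  = atom p
  core bot       = bot
  core top       = top
  core (A ∧ B)   = wrap (S kConj) (core A) ∧ wrap (S kConj) (core B)
  core (A ∨ B)   = wrap (S kDisj) (core A) ∨ wrap (S kDisj) (core B)
  core (A ⇒ B)   = wrap (S kImp) (core A) ⇒ wrap (S kImp) (core B)
  core (all x A) = all x (¬¬ core A)
  core (ex x A)  = ex x (wrap (S kEx) (core A))

  strip-or-keep : ∀ o b {X Y : N} →
    (if b then bin o X Y else bin o (¬¬ X) (¬¬ Y)) ≡ bin o (wrap b X) (wrap b Y)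
  strip-or-keep o true  = refl
  strip-or-keep o false = refl

  removeInside-ko : ∀ A → removeInside S (ko A) ≡ ¬¬ core A
  removeInside-ko (atom p) = refl
  removeInside-ko bot = refl
  removeInside-ko top = refl
  removeInside-ko (A ∧ B) rewrite removeInside-ko A | removeInside-ko B =
    cong ¬¬_ (strip-or-keep conj (S kConj))
  removeInside-ko (A ∨ B) rewrite removeInside-ko A | removeInside-ko B =
    cong ¬¬_ (strip-or-keep disj (S kDisj))
  removeInside-ko (A ⇒ B) rewrite removeInside-ko A | removeInside-ko B =
    cong ¬¬_ (strip-or-keep imp (S kImp))
  removeInside-ko (all x A) rewrite removeInside-ko A = refl
  removeInside-ko (ex x A) rewrite removeInside-ko A with S kEx
  ... | true  = refl
  ... | false = refl

  ko-reduces : ∀ A → ko A ↠[ weight S (ko A) ] ¬¬ core A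
  ko-reduces (atom p)  = cast (sym (weight-zero S (ko (atom p)) (λ _ → refl))) done
  ko-reduces bot       = cast (sym (weight-zero S (ko {Atom} bot) (λ _ → refl))) done
  ko-reduces top       = cast (sym (weight-zero S (ko {Atom} top) (λ _ → refl))) done
  ko-reduces (A ∧ B)   = cast (sym (weight-bin S conj (ko A) (ko B)))
                              (reduce-bin conj (ko-reduces A) (ko-reduces B))
  ko-reduces (A ∨ B)   = cast (sym (weight-bin S disj (ko A) (ko B)))
                              (reduce-bin disj (ko-reduces A) (ko-reduces B))
  ko-reduces (A ⇒ B)   = cast (sym (weight-bin S imp (ko A) (ko B)))
                              (reduce-bin imp (ko-reduces A) (ko-reduces B))
  ko-reduces (all x A) = under (λ X → ¬¬ all x X) (λ s → ¬¬-step (all· s)) (ko-reduces A)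
  ko-reduces (ex x A)  =
    cast (trans (+-comm (weight S (ko A)) (kept (S kEx) 1)) (sym (weight-ex S x (ko A))))
      (under (λ X → ¬¬ ex x X) (λ s → ¬¬-step (ex· s)) (ko-reduces A)
       ++ contract-ex (S kEx) refl)

  core-not-neg : ∀ A → ¬ IsNeg (core A)
  core-not-neg (atom p)  ()
  core-not-neg bot       ()
  core-not-neg top       ()
  core-not-neg (A ∧ B)   ()
  core-not-neg (A ∨ B)   ()
  core-not-neg (A ⇒ B)   ()
  core-not-neg (all x A) ()
  core-not-neg (ex x A)  ()

  no-root-¬¬core : ∀ A {C : N} → ¬ Root S (¬¬ core A) C
  no-root-¬¬core (atom p)  ()
  no-root-¬¬core bot       ()
  no-root-¬¬core top       ()
  no-root-¬¬core (A ∧ B)   = no-root-bin conj (S kConj) refl (core-not-neg A)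
  no-root-¬¬core (A ∨ B)   = no-root-bin disj (S kDisj) refl (core-not-neg A)
  no-root-¬¬core (A ⇒ B)   = no-root-bin imp (S kImp) refl (core-not-neg A)
  no-root-¬¬core (all x A) ()
  no-root-¬¬core (ex x A)  = no-root-ex (S kEx) refl (core-not-neg A)

  core-normal   : ∀ A → Normal S (core A)
  ¬¬core-normal : ∀ A → Normal S (¬¬ core A)

  core-normal (atom p) _ (here ())
  core-normal bot      _ (here ())
  core-normal top      _ (here ())
  core-normal (A ∧ B)  = normal-bin conj (normal-wrap (S kConj) (core-normal A) (¬¬core-normal A))
                                         (normal-wrap (S kConj) (core-normal B) (¬¬core-normal B))
  core-normal (A ∨ B)  = normal-bin disj (normal-wrap (S kDisj) (core-normal A) (¬¬core-normal A))
                                         (normal-wrap (S kDisj) (core-normal B) (¬¬core-normal B))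
  core-normal (A ⇒ B)  = normal-bin imp (normal-wrap (S kImp) (core-normal A) (¬¬core-normal A))
                                        (normal-wrap (S kImp) (core-normal B) (¬¬core-normal B))
  core-normal (all x A) = normal-all (¬¬core-normal A)
  core-normal (ex x A)  = normal-ex (normal-wrap (S kEx) (core-normal A) (¬¬core-normal A))

  ¬¬core-normal A = normal-¬¬ (core-normal A) (core-not-neg A) (no-root-¬¬core A)

lemma11 : {Atom : Set} (S : RuleSet) (A : Form Atom) →
    Σ (NForm Atom) (λ B → Σ (Path S (ko A) B) (λ P →
    (s S P ≡ weight S (ko A)) × (B ≡ removeInside S (ko A))))
lemma11 S A with toSteps S (ko-reduces S A)
... | steps , length =
  ¬¬ core S A , path steps (¬¬core-normal S A) , length , sym (removeInside-ko S A)
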